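{- Let the diamond graph be the graph on vertices $d_1,d_2,d_3,d_4$ with edges $d_1d_2$, $d_1d_3$, $d_2d_3$, $d_2d_4$, $d_3d_4$ (i.e. $K_4$ minus the edge $d_1d_4$). Let $H$ be the $(d_1,1)$-ordering of the diamond graph. Then $R_<(H)\le 14$.
   Context: A $k$-ordering of a graph $H$ assigns distinct order-labels from $\{1,\ldots,|H|\}$ to $k$ of the vertices of $H$. For a vertex $v$ of $H$ and $1\le l\le |H|$, the $(v,l)$-ordering of $H$ is the 1-ordering in which $v$ receives order-label $l$ and no other vertex is labeled. An ordered 2-coloring on $n$ vertices is a red/blue coloring of the edges of the complete graph on vertex set $\{1,\ldots,n\}$. It contains a $k$-ordering $H$ (in a given color) if it has a subgraph isomorphic to $H$, all of whose edges have that color, such that for every $i$ the $i$-th smallest vertex of the copy corresponds to a vertex of $H$ that has order-label $i$ or no order-label. $R_<(H)$ is the least $n$ such that every ordered 2-coloring on $n$ vertices contains a monochromatic (red or blue) copy of $H$. -}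

module Defs where

open import Data.Nat using (ℕ; _≤_)
open import Data.Fin using (Fin; zero; suc; toℕ; _<_; _<?_)
open import Data.Fin.Patterns using (0F; 1F; 2F; 3F)
open import Data.List using (List; []; _∷_; length; filter; allFin)
open import Data.List.Relation.Unary.All using (All)
open import Data.Maybe using (Maybe; just; nothing)
open import Data.Product using (_×_; _,_; ∃-syntax)
open import Data.Sum using (_⊎_)
open import Function.Definitions using (Injective)
open import Relation.Binary.PropositionalEquality using (_≡_)

data Colour : Set where
  red blue : Colour

record Graph : Set where
  field
    size  : ℕ
    edges : List (Fin size × Fin size)
open Graph public

-- Label l : Fin |H| stands for the order-label (toℕ l + 1) ∈ {1,…,|H|}.
-- 'nothing' means unlabelled.
record Ordering : Set where
  field
    graph  : Graph
    label  : Fin (size graph) → Maybe (Fin (size graph))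
    labelsDistinct : ∀ u v l → label u ≡ just l → label v ≡ just l → u ≡ v
open Ordering public

oneOrdering : (G : Graph) → Fin (size G) → Fin (size G) → Ordering
oneOrdering G v l = record
  { graph = G
  ; label = lab
  ; labelsDistinct = distinct
  }
  where
  open import Relation.Nullary using (yes; no)
  open import Data.Fin using (_≟_)
  open import Relation.Binary.PropositionalEquality using (refl; trans; sym)
  lab : Fin (size G) → Maybe (Fin (size G))
  lab u with u ≟ v
  ... | yes _ = just l
  ... | no  _ = nothing
  distinct : ∀ u w l' → lab u ≡ just l' → lab w ≡ just l' → u ≡ w
  distinct u w l' p q with u ≟ v | w ≟ v
  distinct u w l' p q | yes a | yes b = trans a (sym b)
  distinct u w l' () q | no _ | _
  distinct u w l' p () | yes _ | no _

-- An ordered 2-colouring on n vertices: a colour for each pair i < j of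
-- {1,…,n} (vertex i represented by Fin n; c i j is used only for i < j).
OrderedColouring : ℕ → Set
OrderedColouring n = Fin n → Fin n → Colour

EdgeColoured : ∀ {n} → OrderedColouring n → Colour → Fin n → Fin n → Set
EdgeColoured c col u v = (u < v × c u v ≡ col) ⊎ (v < u × c v u ≡ col)

-- 0-based rank of the vertex f v among the image of f (number of
-- vertices of H mapped strictly below f v).
rank : ∀ {m n} → (Fin m → Fin n) → Fin m → ℕ
rank {m} f v = length (filter (λ w → f w <? f v) (allFin m))

ContainsIn : ∀ {n} → OrderedColouring n → Colour → Ordering → Set
ContainsIn {n} c col H =
  ∃[ f ] (Injective _≡_ _≡_ f
         × All (λ e → EdgeColoured c col (f (Data.Product.proj₁ e)) (f (Data.Product.proj₂ e)))
               (edges (graph H))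
         × (∀ v l → label H v ≡ just l → rank f v ≡ toℕ l))
  where import Data.Product

Arrows : ℕ → Ordering → Set
Arrows n H = (c : OrderedColouring n) → ContainsIn c red H ⊎ ContainsIn c blue H

-- R_<(H) ≤ N : the least n with Arrows n H is at most N, i.e. some n ≤ N works.
OrderedRamsey≤ : Ordering → ℕ → Set
OrderedRamsey≤ H N = ∃[ n ] (n ≤ N × Arrows n H)

-- The diamond graph: d₁,d₂,d₃,d₄ ↦ 0,1,2,3; K₄ minus edge d₁d₄.
diamond : Graph
diamond = record
  { size = 4
  ; edges = (0F , 1F) ∷ (0F , 2F) ∷ (1F , 2F) ∷ (1F , 3F) ∷ (2F , 3F) ∷ []
  }

-- The (d₁,1)-ordering of the diamond (order-label 1 encoded as 0F).
diamond-d₁-1 : Ordering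
diamond-d₁-1 = oneOrdering diamond 0F 0F

-- Fix the least vertex o. A diamond-free colouring has no monochromatic K₄ and, for a < t,
-- the common κ-neighbours of a and t above a span no κ-edge, so they form a clique of the other
-- colour and number at most 3. Applied inside the κ-neighbourhood of o above o, this caps that
-- neighbourhood at 8 vertices. With 13 vertices above o both neighbourhoods then have between 5
-- and 8 vertices, and double counting the edges between them gives t s ≤ 3 t + 3 s, which fails
-- for s + t = 13.
module Submission where

open import Defs
open import Data.Bool using (true; false; if_then_else_)
open import Data.Empty using (⊥-elim)
open import Data.Fin using (Fin; suc; toℕ; _<_; _<?_; _≟_)
open import Data.Fin.Patterns using (0F)
open import Data.Fin.Properties using (<⇒≢; <-cmp; <-asym; <-irrefl; any?)
open import Data.List using (List; []; _∷_; length; filter; map; tabulate)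
open import Data.List.Properties using (map-cong; filter-none; filter-≐; length-tabulate)
open import Data.List.Relation.Unary.All as All using (All; []; _∷_)
open import Data.List.Relation.Unary.All.Properties using (all-filter; filter⁺; tabulate⁺)
open import Data.List.Relation.Unary.AllPairs using (AllPairs; []; _∷_)
import Data.List.Relation.Unary.AllPairs.Properties as AllPairs
open import Data.Maybe using (just)
open import Data.Nat as ℕ using (ℕ; z≤n; s≤s; s≤s⁻¹; z<s; s<s; _+_; _*_)
open import Data.Nat.ListAction using (sum)
open import Data.Nat.Properties as ℕ using (≤-refl; ≤-trans; +-mono-≤; +-monoˡ-≤; +-monoʳ-≤)
open import Data.Nat.Tactic.RingSolver using (solve-∀)
open import Data.Product using (_×_; _,_; ∃-syntax; proj₂)
open import Data.Sum using (_⊎_; inj₁; inj₂)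
open import Data.Vec using (Vec; []; _∷_; lookup)
open import Data.Vec.Relation.Unary.All using ([]; _∷_)
open import Data.Vec.Relation.Unary.AllPairs using ([]; _∷_)
open import Data.Vec.Relation.Unary.Unique.Propositional using (Unique)
open import Data.Vec.Relation.Unary.Unique.Propositional.Properties using (lookup-injective)
open import Function using (_∘_)
open import Level using (0ℓ)
open import Relation.Binary using (tri<; tri≈; tri>)
open import Relation.Binary.PropositionalEquality using (_≡_; _≢_; refl; sym; trans; cong; cong₂; subst; module ≡-Reasoning)
open import Relation.Nullary using (¬_; Dec; yes; no; does; contradiction)
open import Relation.Nullary.Decidable using (_×-dec_; ¬?)
open import Relation.Unary using (Pred; Decidable; _≐_)

open import Algebra.Properties.CommutativeSemigroup ℕ.+-commutativeSemigroup using () renaming (interchange to +-interchange)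

opposite : Colour → Colour
opposite red  = blue
opposite blue = red

opposite-involutive : ∀ κ → opposite (opposite κ) ≡ κ
opposite-involutive red  = refl
opposite-involutive blue = refl

opposite-≢ : ∀ κ → κ ≢ opposite κ
opposite-≢ red  ()
opposite-≢ blue ()

≢⇒≡opposite : ∀ {x κ} → x ≢ κ → x ≡ opposite κ
≢⇒≡opposite {red}  {red}  x≢κ = contradiction refl x≢κ
≢⇒≡opposite {red}  {blue} _   = refl
≢⇒≡opposite {blue} {red}  _   = refl
≢⇒≡opposite {blue} {blue} x≢κ = contradiction refl x≢κ

_≟ᶜ_ : (x y : Colour) → Dec (x ≡ y)
red  ≟ᶜ red  = yes refl
red  ≟ᶜ blue = no λ ()
blue ≟ᶜ red  = no λ ()
blue ≟ᶜ blue = yes refl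

≢-by-colour : ∀ {A : Set} {g : A → Colour} {x y κ κ′} → g x ≡ κ → g y ≡ κ′ → κ ≢ κ′ → x ≢ y
≢-by-colour gx≡κ gy≡κ′ κ≢κ′ refl = κ≢κ′ (trans (sym gx≡κ) gy≡κ′)

module _ {A : Set} where

  sum-map-+ : ∀ (f g : A → ℕ) xs → sum (map (λ x → f x + g x) xs) ≡ sum (map f xs) + sum (map g xs)
  sum-map-+ f g []       = refl
  sum-map-+ f g (x ∷ xs) =
    trans (cong (f x + g x +_) (sum-map-+ f g xs)) (+-interchange (f x) (g x) _ _)

  sum-map-const : ∀ k (xs : List A) → sum (map (λ _ → k) xs) ≡ length xs * k
  sum-map-const k []       = refl
  sum-map-const k (x ∷ xs) = cong (k +_) (sum-map-const k xs)

  sum-map-mono-≤ : ∀ {f g : A → ℕ} {xs} → All (λ x → f x ℕ.≤ g x) xs → sum (map f xs) ℕ.≤ sum (map g xs)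
  sum-map-mono-≤ []         = z≤n
  sum-map-mono-≤ (le ∷ les) = +-mono-≤ le (sum-map-mono-≤ les)

  module _ {P : Pred A 0ℓ} (P? : Decidable P) where

    length-filter-∷ : ∀ x xs → length (filter P? (x ∷ xs)) ≡ (if does (P? x) then 1 else 0) + length (filter P? xs)
    length-filter-∷ x xs with does (P? x)
    ... | true  = refl
    ... | false = refl

    length-filter≡sum : ∀ xs → length (filter P? xs) ≡ sum (map (λ x → if does (P? x) then 1 else 0) xs)
    length-filter≡sum []       = refl
    length-filter≡sum (x ∷ xs) = trans (length-filter-∷ x xs) (cong (_ +_) (length-filter≡sum xs))

module _ {A B : Set} {R : A → B → Set} (R? : ∀ x y → Dec (R x y)) where

  sum-length-filter-comm : ∀ xs ys →
    sum (map (λ x → length (filter (R? x) ys)) xs) ≡ sum (map (λ y → length (filter (λ x → R? x y) xs)) ys)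
  sum-length-filter-comm [] ys = sym (trans (sum-map-const 0 ys) (ℕ.*-zeroʳ (length ys)))
  sum-length-filter-comm (x ∷ xs) ys = begin
    length (filter (R? x) ys) + sum (map (λ x → length (filter (R? x) ys)) xs)
      ≡⟨ cong₂ _+_ (length-filter≡sum (R? x) ys) (sum-length-filter-comm xs ys) ⟩
    sum (map 𝟙[x,_] ys) + sum (map (λ y → length (filter (λ x → R? x y) xs)) ys)
      ≡⟨ sum-map-+ 𝟙[x,_] _ ys ⟨
    sum (map (λ y → 𝟙[x, y ] + length (filter (λ x → R? x y) xs)) ys)
      ≡⟨ cong sum (map-cong (λ y → length-filter-∷ (λ x → R? x y) x xs) ys) ⟨
    sum (map (λ y → length (filter (λ x → R? x y) (x ∷ xs))) ys) ∎
    where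
    open ≡-Reasoning
    𝟙[x,_] : B → ℕ
    𝟙[x, y ] = if does (R? x y) then 1 else 0

length-filter-colour : ∀ {A : Set} (g : A → Colour) κ xs →
  length (filter (λ x → g x ≟ᶜ κ) xs) + length (filter (λ x → g x ≟ᶜ opposite κ) xs) ≡ length xs
length-filter-colour g κ [] = refl
length-filter-colour g κ (x ∷ xs) with g x ≟ᶜ κ | g x ≟ᶜ opposite κ
... | yes gx≡κ | yes gx≡κ′ = contradiction (trans (sym gx≡κ) gx≡κ′) (opposite-≢ κ)
... | yes _    | no  _     = cong ℕ.suc (length-filter-colour g κ xs)
... | no  _    | yes _     = trans (ℕ.+-suc _ _) (cong ℕ.suc (length-filter-colour g κ xs))
... | no gx≢κ  | no gx≢κ′  = contradiction (≢⇒≡opposite gx≢κ) gx≢κ′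

complement≥5 : ∀ {s t} → s + t ≡ 13 → t ℕ.≤ 8 → 5 ℕ.≤ s
complement≥5 {s} s+t≡13 t≤8 = ℕ.+-cancelʳ-≤ 8 5 s (subst (ℕ._≤ s + 8) s+t≡13 (+-monoʳ-≤ s t≤8))

-- With s = 5 + a and t = 5 + b we have a + b = 3, so t s = 40 + b a > 39.
balanced-split : ∀ {s t} → s + t ≡ 13 → s ℕ.≤ 8 → t ℕ.≤ 8 → t * 3 + s * 3 ℕ.< t * s
balanced-split {s} {t} s+t≡13 s≤8 t≤8
  with a , refl ← ℕ.m≤n⇒∃[o]m+o≡n (complement≥5 {s} {t} s+t≡13 t≤8)
  with b , refl ← ℕ.m≤n⇒∃[o]m+o≡n (complement≥5 {t} {s} (trans (ℕ.+-comm t s) s+t≡13) s≤8) = begin-strict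
  (5 + b) * 3 + (5 + a) * 3   ≡⟨ linear a b ⟩
  30 + 3 * (a + b)            ≡⟨ cong (λ k → 30 + 3 * k) a+b≡3 ⟩
  39                          <⟨ ℕ.m≤m+n 40 (b * a) ⟩
  40 + b * a                  ≡⟨ cong (λ k → 25 + 5 * k + b * a) a+b≡3 ⟨
  25 + 5 * (a + b) + b * a    ≡⟨ quadratic a b ⟨
  (5 + b) * (5 + a)           ∎
  where
  open ℕ.≤-Reasoning
  a+b≡3 : a + b ≡ 3
  a+b≡3 = ℕ.+-cancelˡ-≡ 10 (a + b) 3 (trans (sym (sum-shift a b)) s+t≡13)
    where
    sum-shift : ∀ a b → (5 + a) + (5 + b) ≡ 10 + (a + b)
    sum-shift = solve-∀
  linear : ∀ a b → (5 + b) * 3 + (5 + a) * 3 ≡ 30 + 3 * (a + b)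
  linear = solve-∀
  quadratic : ∀ a b → (5 + b) * (5 + a) ≡ 25 + 5 * (a + b) + b * a
  quadratic = solve-∀

module Colouring {n : ℕ} (c : OrderedColouring n) where

  colour : Fin n → Fin n → Colour
  colour u v with u <? v
  ... | yes _ = c u v
  ... | no  _ = c v u

  colour-< : ∀ {u v} → u < v → colour u v ≡ c u v
  colour-< {u} {v} u<v with u <? v
  ... | yes _   = refl
  ... | no  u≮v = contradiction u<v u≮v

  colour-> : ∀ {u v} → v < u → colour u v ≡ c v u
  colour-> {u} {v} v<u with u <? v
  ... | yes u<v = contradiction v<u (<-asym u<v)
  ... | no  _   = refl

  colour-sym : ∀ u v → colour u v ≡ colour v u
  colour-sym u v with <-cmp u v
  ... | tri< u<v _ _    = trans (colour-< u<v) (sym (colour-> u<v))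
  ... | tri≈ _ refl _   = refl
  ... | tri> _ _ v<u    = trans (colour-> v<u) (sym (colour-< v<u))

  colour⇒edgeColoured : ∀ {κ u v} → u ≢ v → colour u v ≡ κ → EdgeColoured c κ u v
  colour⇒edgeColoured {u = u} {v} u≢v uv≡κ with <-cmp u v
  ... | tri< u<v _ _   = inj₁ (u<v , trans (sym (colour-< u<v)) uv≡κ)
  ... | tri≈ _ u≡v _   = contradiction u≡v u≢v
  ... | tri> _ _ v<u   = inj₂ (v<u , trans (sym (colour-> v<u)) uv≡κ)

  neighbours : Colour → Fin n → List (Fin n) → List (Fin n)
  neighbours κ v = filter (λ y → colour v y ≟ᶜ κ)

  neighbours-all : ∀ {P : Fin n → Set} κ v {xs} → All P xs → All (λ y → P y × colour v y ≡ κ) (neighbours κ v xs)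
  neighbours-all κ v {xs} Pxs = All.zip (filter⁺ _ Pxs , all-filter _ xs)

  neighbours-sorted : ∀ κ v {xs} → AllPairs _<_ xs → AllPairs _<_ (neighbours κ v xs)
  neighbours-sorted κ v = AllPairs.filter⁺ _

  length-neighbours : ∀ κ v xs → length (neighbours κ v xs) + length (neighbours (opposite κ) v xs) ≡ length xs
  length-neighbours κ v = length-filter-colour (colour v) κ

  sum-length-neighbours-comm : ∀ κ xs ys →
    sum (map (λ x → length (neighbours κ x ys)) xs) ≡ sum (map (λ y → length (neighbours κ y xs)) ys)
  sum-length-neighbours-comm κ xs ys = trans (sum-length-filter-comm (λ x y → colour x y ≟ᶜ κ) xs ys)
    (cong sum (map-cong (λ y → cong length (filter-≐ _ _ (flip-colour y) xs)) ys))
    where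
    flip-colour : ∀ y → (λ x → colour x y ≡ κ) ≐ (λ x → colour y x ≡ κ)
    flip-colour y = (λ {x} e → trans (colour-sym y x) e) , (λ {x} e → trans (colour-sym x y) e)

  crossing-bound : ∀ κ p q S T →
    All (λ t → length (neighbours κ t S) ℕ.≤ p) T →
    All (λ s → length (neighbours (opposite κ) s T) ℕ.≤ q) S →
    length T * length S ℕ.≤ length T * p + length S * q
  crossing-bound κ p q S T few-κ few-κ′ = begin
    length T * length S
      ≡⟨ sum-map-const (length S) T ⟨
    sum (map (λ _ → length S) T)
      ≡⟨ cong sum (map-cong (λ t → length-neighbours κ t S) T) ⟨
    sum (map (λ t → length (neighbours κ t S) + length (neighbours (opposite κ) t S)) T)
      ≤⟨ sum-map-mono-≤ (All.map (+-monoˡ-≤ _) few-κ) ⟩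
    sum (map (λ t → p + length (neighbours (opposite κ) t S)) T)
      ≡⟨ sum-map-+ (λ _ → p) _ T ⟩
    sum (map (λ _ → p) T) + sum (map (λ t → length (neighbours (opposite κ) t S)) T)
      ≡⟨ cong₂ _+_ (sum-map-const p T) (sum-length-neighbours-comm (opposite κ) T S) ⟩
    length T * p + sum (map (λ s → length (neighbours (opposite κ) s T)) S)
      ≤⟨ +-monoʳ-≤ (length T * p) (sum-map-mono-≤ few-κ′) ⟩
    length T * p + sum (map (λ _ → q) S)
      ≡⟨ cong (length T * p +_) (sum-map-const q S) ⟩
    length T * p + length S * q ∎
    where open ℕ.≤-Reasoning

  -- The copy d₁ ↦ a, d₂ ↦ b, d₃ ↦ x, d₄ ↦ d, with d₁ the least of the four vertices.
  IsMonoDiamond : Colour → (a b x d : Fin n) → Set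
  IsMonoDiamond κ a b x d = a < b × a < x × a < d × b ≢ x × b ≢ d × x ≢ d
    × colour a b ≡ κ × colour a x ≡ κ × colour b x ≡ κ × colour b d ≡ κ × colour x d ≡ κ

  isMonoDiamond? : ∀ κ a b x d → Dec (IsMonoDiamond κ a b x d)
  isMonoDiamond? κ a b x d =
    a <? b ×-dec a <? x ×-dec a <? d ×-dec ¬? (b ≟ x) ×-dec ¬? (b ≟ d) ×-dec ¬? (x ≟ d)
    ×-dec colour a b ≟ᶜ κ ×-dec colour a x ≟ᶜ κ ×-dec colour b x ≟ᶜ κ ×-dec colour b d ≟ᶜ κ ×-dec colour x d ≟ᶜ κ

  HasMonoDiamond : Set
  HasMonoDiamond = ∃[ κ ] ∃[ a ] ∃[ b ] ∃[ x ] ∃[ d ] IsMonoDiamond κ a b x d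

  hasMonoDiamond? : Dec HasMonoDiamond
  hasMonoDiamond? = any-colour? λ κ → any? λ a → any? λ b → any? λ x → any? λ d → isMonoDiamond? κ a b x d
    where
    any-colour? : {P : Colour → Set} → (∀ κ → Dec (P κ)) → Dec (∃[ κ ] P κ)
    any-colour? P? with P? red | P? blue
    ... | yes p | _     = yes (red , p)
    ... | no _  | yes q = yes (blue , q)
    ... | no ¬p | no ¬q = no λ { (red , p) → ¬p p ; (blue , q) → ¬q q }

  monoDiamond⇒contains : ∀ {κ a b x d} → IsMonoDiamond κ a b x d → ContainsIn c κ diamond-d₁-1
  monoDiamond⇒contains {κ} {a} {b} {x} {d} (a<b , a<x , a<d , b≢x , b≢d , x≢d , ab , ax , bx , bd , xd) =
    f , (λ {i} {j} → lookup-injective distinct i j) , edges-coloured , least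
    where
    vs : Vec (Fin n) 4
    vs = a ∷ b ∷ x ∷ d ∷ []
    f : Fin 4 → Fin n
    f = lookup vs
    distinct : Unique vs
    distinct = (<⇒≢ a<b ∷ <⇒≢ a<x ∷ <⇒≢ a<d ∷ []) ∷ (b≢x ∷ b≢d ∷ []) ∷ (x≢d ∷ []) ∷ [] ∷ []
    edges-coloured : All (λ (i , j) → EdgeColoured c κ (f i) (f j)) (edges (graph diamond-d₁-1))
    edges-coloured = colour⇒edgeColoured (<⇒≢ a<b) ab ∷ colour⇒edgeColoured (<⇒≢ a<x) ax
      ∷ colour⇒edgeColoured b≢x bx ∷ colour⇒edgeColoured b≢d bd ∷ colour⇒edgeColoured x≢d xd ∷ []
    least : ∀ v l → label diamond-d₁-1 v ≡ just l → rank f v ≡ toℕ l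
    least 0F .0F refl = cong length (filter-none (λ w → f w <? a) (<-irrefl refl ∷ <-asym a<b ∷ <-asym a<x ∷ <-asym a<d ∷ []))

  Clique : Colour → List (Fin n) → Set
  Clique κ = AllPairs (λ y z → y < z × colour y z ≡ κ)

  pairwise⇒clique : ∀ {κ} {P : Fin n → Set} {M} → (∀ {y z} → P y → P z → y < z → colour y z ≡ κ) →
                    AllPairs _<_ M → All P M → Clique κ M
  pairwise⇒clique edge []               []         = []
  pairwise⇒clique edge (y<M ∷ sorted) (Py ∷ PM) =
    All.zipWith (λ (y<z , Pz) → y<z , edge Py Pz y<z) (y<M , PM) ∷ pairwise⇒clique edge sorted PM

  UpperNeighbour : Colour → Fin n → Fin n → Set
  UpperNeighbour κ a y = a < y × colour a y ≡ κ

  module DiamondFree (free : ¬ HasMonoDiamond) where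

    clique-length≤3 : ∀ {κ M} → Clique κ M → length M ℕ.≤ 3
    clique-length≤3 []                           = z≤n
    clique-length≤3 (_ ∷ [])                     = s≤s z≤n
    clique-length≤3 (_ ∷ _ ∷ [])                 = s≤s (s≤s z≤n)
    clique-length≤3 (_ ∷ _ ∷ _ ∷ [])             = s≤s (s≤s (s≤s z≤n))
    clique-length≤3 {κ} {x₁ ∷ x₂ ∷ x₃ ∷ x₄ ∷ _}
      (((x₁<x₂ , e₁₂) ∷ (x₁<x₃ , e₁₃) ∷ (x₁<x₄ , _) ∷ _) ∷ ((x₂<x₃ , e₂₃) ∷ (x₂<x₄ , e₂₄) ∷ _) ∷ ((x₃<x₄ , e₃₄) ∷ _) ∷ _) =
      ⊥-elim (free (κ , x₁ , x₂ , x₃ , x₄ , x₁<x₂ , x₁<x₃ , x₁<x₄ , <⇒≢ x₂<x₃ , <⇒≢ x₂<x₄ , <⇒≢ x₃<x₄ , e₁₂ , e₁₃ , e₂₃ , e₂₄ , e₃₄))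

    CommonNeighbour : Colour → Fin n → Fin n → Fin n → Set
    CommonNeighbour κ a t y = (UpperNeighbour κ a y × y ≢ t) × colour t y ≡ κ

    -- A κ-edge yz would complete the diamond (a, y, z, t).
    commonNeighbours-opposite : ∀ {κ a t y z} → a < t → CommonNeighbour κ a t y → CommonNeighbour κ a t z →
                                y < z → colour y z ≡ opposite κ
    commonNeighbours-opposite {κ} {a} {t} {y} {z} a<t (((a<y , ay) , y≢t) , ty) (((a<z , az) , z≢t) , tz) y<z =
      ≢⇒≡opposite λ yz → free (κ , a , y , z , t , a<y , a<z , a<t , <⇒≢ y<z , y≢t , z≢t
                              , ay , az , yz , trans (colour-sym y t) ty , trans (colour-sym z t) tz)

    commonNeighbours-clique : ∀ {κ a t M} → a < t → AllPairs _<_ M → All (CommonNeighbour κ a t) M →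
                              Clique (opposite κ) M
    commonNeighbours-clique a<t = pairwise⇒clique (commonNeighbours-opposite a<t)

    commonNeighbours-length≤3 : ∀ {κ a t L} → a < t → AllPairs _<_ L →
      All (λ y → UpperNeighbour κ a y × y ≢ t) L → length (neighbours κ t L) ℕ.≤ 3
    commonNeighbours-length≤3 {κ} {a} {t} a<t sorted upper =
      clique-length≤3 (commonNeighbours-clique a<t (neighbours-sorted κ t sorted) (neighbours-all κ t upper))

    CrossNeighbour : Colour → Fin n → Fin n → Fin n → Set
    CrossNeighbour κ o r y = (r < y × UpperNeighbour κ o y) × colour r y ≡ opposite κ

    -- Split by the colour of the edge to w: each class plus an apex (r, resp. o) is a clique.
    crossNeighbours-length≤4 : ∀ {κ o r w Z} → UpperNeighbour κ o w → r < w → AllPairs _<_ Z →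
      All (λ y → CrossNeighbour κ o r y × y ≢ w) Z → length Z ℕ.≤ 4
    crossNeighbours-length≤4 {κ} {o} {r} {w} {Z} (o<w , _) r<w sorted cross = begin
      length Z
        ≡⟨ length-neighbours κ w Z ⟨
      length (neighbours κ w Z) + length (neighbours (opposite κ) w Z)
        ≤⟨ +-mono-≤ κ-class κ′-class ⟩
      4 ∎
      where
      open ℕ.≤-Reasoning
      κ-class : length (neighbours κ w Z) ℕ.≤ 2
      κ-class = s≤s⁻¹ (clique-length≤3 (apex ∷ commonNeighbours-clique o<w (neighbours-sorted κ w sorted) common))
        where
        apex : All (λ y → r < y × colour r y ≡ opposite κ) (neighbours κ w Z)
        apex = All.map (λ ((((r<y , _) , ry) , _) , _) → r<y , ry) (neighbours-all κ w cross)
        common : All (CommonNeighbour κ o w) (neighbours κ w Z)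
        common = All.map (λ ((((_ , o-y) , _) , y≢w) , wy) → (o-y , y≢w) , wy) (neighbours-all κ w cross)
      κ′-class : length (neighbours (opposite κ) w Z) ℕ.≤ 2
      κ′-class = s≤s⁻¹ (clique-length≤3 (apex ∷ commonNeighbours-clique r<w (neighbours-sorted (opposite κ) w sorted) common))
        where
        apex : All (λ y → o < y × colour o y ≡ opposite (opposite κ)) (neighbours (opposite κ) w Z)
        apex = All.map (λ ((((_ , o<y , oy) , _) , _) , _) → o<y , trans oy (sym (opposite-involutive κ)))
                       (neighbours-all (opposite κ) w cross)
        common : All (CommonNeighbour (opposite κ) r w) (neighbours (opposite κ) w Z)
        common = All.map (λ ((((r<y , _) , ry) , y≢w) , wy) → ((r<y , ry) , y≢w) , wy) (neighbours-all (opposite κ) w cross)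

    -- With r the least κ-neighbour of o, the other κ-neighbours split by the colour of their edge to r.
    -- At most 3 are joined to r in colour κ; if one such w exists, the rest are cross neighbours
    -- avoiding w, else the least remaining one serves as w.
    upperNeighbourhood-length≤8 : ∀ {κ o S} → AllPairs _<_ S → All (UpperNeighbour κ o) S → length S ℕ.≤ 8
    upperNeighbourhood-length≤8 [] [] = z≤n
    upperNeighbourhood-length≤8 {κ} {o} {r ∷ S} (r<S ∷ sorted) ((o<r , _) ∷ upper) = s≤s (begin
      length S
        ≡⟨ length-neighbours κ r S ⟨
      length (neighbours κ r S) + length (neighbours (opposite κ) r S)
        ≤⟨ classes-bound _ _ κ-class≤3 (neighbours-all κ r above-r) (neighbours-sorted (opposite κ) r sorted)
                         (neighbours-all (opposite κ) r above-r) ⟩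
      7 ∎)
      where
      open ℕ.≤-Reasoning
      above-r : All (λ y → r < y × UpperNeighbour κ o y) S
      above-r = All.zip (r<S , upper)
      κ-class≤3 : length (neighbours κ r S) ℕ.≤ 3
      κ-class≤3 = commonNeighbours-length≤3 o<r sorted (All.map (λ (r<y , up-y) → up-y , <⇒≢ r<y ∘ sym) above-r)
      classes-bound : ∀ X Y → length X ℕ.≤ 3 → All (λ w → (r < w × UpperNeighbour κ o w) × colour r w ≡ κ) X →
        AllPairs _<_ Y → All (CrossNeighbour κ o r) Y → length X + length Y ℕ.≤ 7
      classes-bound [] [] _ _ _ _ = z≤n
      classes-bound [] (w ∷ Z) _ _ (w<Z ∷ sorted-Z) (((r<w , up-w) , _) ∷ cross-Z) =
        s≤s (≤-trans (crossNeighbours-length≤4 up-w r<w sorted-Z (All.zipWith (λ (cy , w<y) → cy , <⇒≢ w<y ∘ sym) (cross-Z , w<Z)))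
                     (ℕ.m≤m+n 4 2))
      classes-bound (w ∷ _) Y X≤3 (((r<w , up-w) , rw) ∷ _) sorted-Y cross-Y =
        +-mono-≤ X≤3 (crossNeighbours-length≤4 up-w r<w sorted-Y
          (All.map (λ cy → cy , ≢-by-colour {g = colour r} (proj₂ cy) rw (opposite-≢ κ ∘ sym)) cross-Y))

    -- Each vertex of one neighbourhood of o has at most 3 neighbours in the other one in the
    -- colour of that other one; double count the edges between them.
    length-above≢13 : ∀ {o L} → AllPairs _<_ L → All (o <_) L → length L ≢ 13
    length-above≢13 {o} {L} sorted-L above-o |L|≡13 =
      ℕ.<⇒≱ (balanced-split sizes (upperNeighbourhood-length≤8 (sorted red) (upper red))
                                  (upperNeighbourhood-length≤8 (sorted blue) (upper blue)))
            (crossing-bound red 3 3 (S red) (S blue) (few red) (few blue))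
      where
      S : Colour → List (Fin n)
      S κ = neighbours κ o L
      sizes : length (S red) + length (S blue) ≡ 13
      sizes = trans (length-neighbours red o L) |L|≡13
      upper : ∀ κ → All (UpperNeighbour κ o) (S κ)
      upper κ = neighbours-all κ o above-o
      sorted : ∀ κ → AllPairs _<_ (S κ)
      sorted κ = neighbours-sorted κ o sorted-L
      few : ∀ κ → All (λ t → length (neighbours κ t (S κ)) ℕ.≤ 3) (S (opposite κ))
      few κ = All.map (λ (o<t , ot) → commonNeighbours-length≤3 o<t (sorted κ)
                         (All.map (λ (o<y , oy) → (o<y , oy) , ≢-by-colour oy ot (opposite-≢ κ)) (upper κ)))
                      (upper (opposite κ))

  contains-monoDiamond : ∀ {o L} → AllPairs _<_ L → All (o <_) L → length L ≡ 13 →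
                         ContainsIn c red diamond-d₁-1 ⊎ ContainsIn c blue diamond-d₁-1
  contains-monoDiamond sorted above |L|≡13 with hasMonoDiamond?
  ... | yes (red  , _ , _ , _ , _ , diamond) = inj₁ (monoDiamond⇒contains diamond)
  ... | yes (blue , _ , _ , _ , _ , diamond) = inj₂ (monoDiamond⇒contains diamond)
  ... | no free = contradiction |L|≡13 (DiamondFree.length-above≢13 free sorted above)

theorem3p7 : OrderedRamsey≤ diamond-d₁-1 14
theorem3p7 = 14 , ≤-refl , λ c →
  Colouring.contains-monoDiamond c (AllPairs.tabulate⁺-< {f = above-0} s<s) (tabulate⁺ {f = above-0} λ _ → z<s)
    (length-tabulate above-0)
  where
  above-0 : Fin 13 → Fin 14
  above-0 = suc
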